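{- Let $a,b>0$ be integers and let $\mathcal{W}$ be a set of weights with $\{ -\infty,0,b\}\subseteq\mathcal{W}$ or $\{ -a,b\}\subseteq\mathcal{W}$. Then for every $R\ge 1$ there is a coloring game $G$ with weights in $\mathcal{W}$ such that $f(P^+)\ge R$ and $f(P_1^-)=0$, where $P^+$ is a partition of maximum global utility and $P_1^-$ is a $1$-stable partition of minimum global utility.
   Context: A coloring game $G=(V,w)$ has a finite set of players $V$ and symmetric weights $w_{uv}=w_{vu}$ ($-\infty$ means enemies). For a partition $P$ of $V$ with $X(u)$ the group of $u$, $f_u(P)=\sum_{v\in X(u)\setminus\{u\}} w_{uv}$ and $f(P)=\sum_u f_u(P)$. A $1$-deviation from $P$ is a player $u$ and a (possibly empty) group $X$ of $P$ such that moving $u$ into $X$ strictly increases $f_u$; $P$ is $1$-stable if no $1$-deviation exists. -}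

module Defs where

open import Data.Nat using (ℕ; zero; suc)
open import Data.Integer as ℤ using (ℤ; +_)
open import Data.Fin using (Fin; zero; suc; _≟_)
open import Data.Bool using (Bool; true; false; if_then_else_; _∧_; not)
open import Data.Product using (∃; ∃-syntax; _×_; _,_)
open import Relation.Nullary using (¬_; does)
open import Relation.Binary.PropositionalEquality using (_≡_)
open import Relation.Unary using (Pred)
open import Level using (0ℓ)

data ℤ∞ : Set where
  -∞  : ℤ∞
  fin : ℤ → ℤ∞

infixl 6 _+∞_
_+∞_ : ℤ∞ → ℤ∞ → ℤ∞
-∞    +∞ _     = -∞
fin _ +∞ -∞    = -∞
fin i +∞ fin j = fin (i ℤ.+ j)

infix 4 _≤∞_ _<∞_
data _≤∞_ : ℤ∞ → ℤ∞ → Set where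
  -∞≤   : ∀ {x} → -∞ ≤∞ x
  fin≤  : ∀ {i j} → i ℤ.≤ j → fin i ≤∞ fin j

data _<∞_ : ℤ∞ → ℤ∞ → Set where
  -∞<   : ∀ {j} → -∞ <∞ fin j
  fin<  : ∀ {i j} → i ℤ.< j → fin i <∞ fin j

sumFin : ∀ {n} → (Fin n → ℤ∞) → ℤ∞
sumFin {zero}  g = fin (+ 0)
sumFin {suc n} g = g zero +∞ sumFin (λ i → g (suc i))

-- A coloring game on the player set V = Fin n, with symmetric weights.
-- (The diagonal w u u is never used.)
record Game : Set where
  field
    n   : ℕ
    w   : Fin n → Fin n → ℤ∞
    sym : ∀ u v → w u v ≡ w v u
open Game public

WeightsIn : Pred ℤ∞ 0ℓ → Game → Set
WeightsIn 𝒲 G = ∀ u v → ¬ (u ≡ v) → 𝒲 (w G u v)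

-- A partition of V is represented by a coloring V → Fin n (group label);
-- the groups are the nonempty fibres. Every partition of V arises this way.
Partition : Game → Set
Partition G = Fin (n G) → Fin (n G)

sameGroup : ∀ {m} → (Fin m → Fin m) → Fin m → Fin m → Bool
sameGroup c u v = does (c u ≟ c v)

utilityOf : (G : Game) → Partition G → Fin (n G) → ℤ∞
utilityOf G c u =
  sumFin (λ v → if not (does (u ≟ v)) ∧ sameGroup c u v then w G u v else fin (+ 0))

globalUtility : (G : Game) → Partition G → ℤ∞
globalUtility G c = sumFin (utilityOf G c)

-- Move player u into the group with label k (an unused label = an empty group).
move : (G : Game) → Partition G → Fin (n G) → Fin (n G) → Partition G
move G c u k v = if does (v ≟ u) then k else c v

OneDeviation : (G : Game) → Partition G → Set
OneDeviation G c = ∃[ u ] ∃[ k ] (utilityOf G c u <∞ utilityOf G (move G c u k) u)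

OneStable : (G : Game) → Partition G → Set
OneStable G c = ¬ OneDeviation G c

IsMaxPartition : (G : Game) → Partition G → Set
IsMaxPartition G P = ∀ Q → globalUtility G Q ≤∞ globalUtility G P

IsMinOneStable : (G : Game) → Partition G → Set
IsMinOneStable G P = OneStable G P × (∀ Q → OneStable G Q → globalUtility G P ≤∞ globalUtility G Q)

module Submission where

-- In a 1-stable partition every player has utility ≥ 0,
-- since a free label always exists and moving there alone yields 0; hence a 1-stable
-- partition of utility 0 is a cheapest one.  A maximum partition exists since there
-- are finitely many colorings.  So it suffices to exhibit a game with a 1-stable
-- partition of utility 0 and some partition of utility ≥ R ('separation').
--   * Enemy gadget ({-∞, 0, b}): a hub x liking m followers; the followers sit with
--     an enemy ex of x, and x sits with an enemy ey of the followers.  Gathering x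
--     with its followers gives f ≥ m·b.
--   * Band game ({-a, b}): a circulant game on 2K + L + 1 players (K = ka, L = 2kb)
--     where players at cyclic distance ≤ K like each other (b) and all others
--     dislike each other (-a).  Every row sums to 2Kb - La = 0, so the grand
--     coalition is 1-stable of utility 0; a block of K + 1 consecutive players
--     has f ≥ K·b.

open import Defs
open import Data.Nat using (ℕ; _≤_)
open import Data.Integer using (+_; -_)
open import Data.Product using (∃; ∃-syntax; _×_; _,_)
open import Data.Sum using (_⊎_)
open import Relation.Binary.PropositionalEquality using (_≡_)
open import Relation.Unary using (Pred)
open import Level using (0ℓ)

open import Function using (_∘_)
open import Data.Nat as ℕ using (zero; suc; _+_; _*_; _∸_; _<_; _<ᵇ_; _≤ᵇ_; ∣_-_∣; z≤n; s≤s)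
import Data.Nat.Properties as ℕP
open import Data.Integer as ℤ using (ℤ)
import Data.Integer.Properties as ℤP
open import Data.Integer.Tactic.RingSolver using (solve-∀)
open import Data.Fin using (Fin; zero; suc; toℕ; punchOut; _≟_)
import Data.Fin.Properties as FP
open import Data.Vec.Functional using (_∷_)
open import Data.Bool using (Bool; true; false; if_then_else_; _∧_; not; T)
open import Data.Unit using (tt)
open import Data.Product using (proj₁; proj₂)
open import Data.Sum using (inj₁; inj₂)
open import Data.Empty using (⊥-elim)
open import Relation.Nullary using (¬_; Dec; yes; no; does)
open import Relation.Nullary.Decidable using (dec-true; dec-false; _×-dec_; ¬?)
open import Relation.Binary.PropositionalEquality
  using (_≢_; refl; trans; cong; cong₂; subst; subst₂; module ≡-Reasoning)
  renaming (sym to ≡-sym)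

0∞ : ℤ∞
0∞ = fin (+ 0)

+∞-identityˡ : ∀ x → 0∞ +∞ x ≡ x
+∞-identityˡ -∞      = refl
+∞-identityˡ (fin i) = cong fin (ℤP.+-identityˡ i)

+∞-identityʳ : ∀ x → x +∞ 0∞ ≡ x
+∞-identityʳ -∞      = refl
+∞-identityʳ (fin i) = cong fin (ℤP.+-identityʳ i)

+∞-comm : ∀ x y → x +∞ y ≡ y +∞ x
+∞-comm -∞      -∞      = refl
+∞-comm -∞      (fin _) = refl
+∞-comm (fin _) -∞      = refl
+∞-comm (fin i) (fin j) = cong fin (ℤP.+-comm i j)

+∞-assoc : ∀ x y z → (x +∞ y) +∞ z ≡ x +∞ (y +∞ z)
+∞-assoc -∞      _       _       = refl
+∞-assoc (fin _) -∞      _       = refl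
+∞-assoc (fin _) (fin _) -∞      = refl
+∞-assoc (fin i) (fin j) (fin k) = cong fin (ℤP.+-assoc i j k)

+∞-zeroʳ : ∀ x → x +∞ -∞ ≡ -∞
+∞-zeroʳ -∞      = refl
+∞-zeroʳ (fin _) = refl

≤∞-refl : ∀ {x} → x ≤∞ x
≤∞-refl { -∞}    = -∞≤
≤∞-refl {fin _} = fin≤ ℤP.≤-refl

≤∞-reflexive : ∀ {x y} → x ≡ y → x ≤∞ y
≤∞-reflexive refl = ≤∞-refl

≤∞-trans : ∀ {x y z} → x ≤∞ y → y ≤∞ z → x ≤∞ z
≤∞-trans -∞≤      _        = -∞≤
≤∞-trans (fin≤ p) (fin≤ q) = fin≤ (ℤP.≤-trans p q)

≤∞-total : ∀ x y → x ≤∞ y ⊎ y ≤∞ x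
≤∞-total -∞      _       = inj₁ -∞≤
≤∞-total (fin _) -∞      = inj₂ -∞≤
≤∞-total (fin i) (fin j) with ℤP.≤-total i j
... | inj₁ i≤j = inj₁ (fin≤ i≤j)
... | inj₂ j≤i = inj₂ (fin≤ j≤i)

-- Trichotomy in the form needed to refute a negative utility.
≤∞-or->∞ : ∀ x y → x ≤∞ y ⊎ y <∞ x
≤∞-or->∞ -∞      _       = inj₁ -∞≤
≤∞-or->∞ (fin _) -∞      = inj₂ -∞<
≤∞-or->∞ (fin i) (fin j) with i ℤP.≤? j
... | yes i≤j = inj₁ (fin≤ i≤j)
... | no  i≰j = inj₂ (fin< (ℤP.≰⇒> i≰j))

<∞⇒≱∞ : ∀ {x y} → x <∞ y → ¬ (y ≤∞ x)
<∞⇒≱∞ -∞<      ()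
<∞⇒≱∞ (fin< p) (fin≤ q) = ℤP.<⇒≱ p q

+∞-mono-≤∞ : ∀ {x x′ y y′} → x ≤∞ x′ → y ≤∞ y′ → x +∞ y ≤∞ x′ +∞ y′
+∞-mono-≤∞ -∞≤      _        = -∞≤
+∞-mono-≤∞ (fin≤ _) -∞≤      = -∞≤
+∞-mono-≤∞ (fin≤ p) (fin≤ q) = fin≤ (ℤP.+-mono-≤ p q)

≤-scale : ∀ n {b} → 1 ≤ b → n ≤ n * b
≤-scale n {suc b} _ = ℕP.m≤m*n n (suc b)

≤∞-product : ∀ {r} n b → r ≤ n * b → fin (+ r) ≤∞ fin (+ n ℤ.* + b)
≤∞-product n b r≤nb = fin≤ (subst (_ ℤ.≤_) (ℤP.pos-* n b) (ℤ.+≤+ r≤nb))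

sumFin-cong : ∀ {n} {g h : Fin n → ℤ∞} → (∀ i → g i ≡ h i) → sumFin g ≡ sumFin h
sumFin-cong {zero}  _  = refl
sumFin-cong {suc n} eq = cong₂ _+∞_ (eq zero) (sumFin-cong (eq ∘ suc))

sumFin-mono : ∀ {n} {g h : Fin n → ℤ∞} → (∀ i → g i ≤∞ h i) → sumFin g ≤∞ sumFin h
sumFin-mono {zero}  _  = ≤∞-refl
sumFin-mono {suc n} le = +∞-mono-≤∞ (le zero) (sumFin-mono (le ∘ suc))

sumFin-zeros : ∀ n → sumFin {n} (λ _ → 0∞) ≡ 0∞
sumFin-zeros zero    = refl
sumFin-zeros (suc n) = cong (0∞ +∞_) (sumFin-zeros n)

sumFin-zero : ∀ {n} {g : Fin n → ℤ∞} → (∀ i → g i ≡ 0∞) → sumFin g ≡ 0∞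
sumFin-zero {n} eq = trans (sumFin-cong eq) (sumFin-zeros n)

sumFin-nonneg : ∀ {n} {g : Fin n → ℤ∞} → (∀ i → 0∞ ≤∞ g i) → 0∞ ≤∞ sumFin g
sumFin-nonneg {n} {g} le = subst (_≤∞ sumFin g) (sumFin-zeros n) (sumFin-mono le)

sumFin-nonpos : ∀ {n} {g : Fin n → ℤ∞} → (∀ i → g i ≤∞ 0∞) → sumFin g ≤∞ 0∞
sumFin-nonpos {n} {g} le = subst (sumFin g ≤∞_) (sumFin-zeros n) (sumFin-mono le)

sumFin-−∞ : ∀ {n} {g : Fin n → ℤ∞} (i : Fin n) → g i ≡ -∞ → sumFin g ≡ -∞
sumFin-−∞ {suc n} zero    eq rewrite eq = refl
sumFin-−∞ {suc n} {g} (suc i) eq rewrite sumFin-−∞ {g = g ∘ suc} i eq = +∞-zeroʳ (g zero)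

sumFin-≥-term : ∀ {n} {g : Fin n → ℤ∞} → (∀ i → 0∞ ≤∞ g i) → ∀ j → g j ≤∞ sumFin g
sumFin-≥-term {suc n} {g} nonneg zero =
  subst (_≤∞ sumFin g) (+∞-identityʳ (g zero)) (+∞-mono-≤∞ ≤∞-refl (sumFin-nonneg (nonneg ∘ suc)))
sumFin-≥-term {suc n} {g} nonneg (suc j) =
  subst (_≤∞ sumFin g) (+∞-identityˡ (g (suc j))) (+∞-mono-≤∞ (nonneg zero) (sumFin-≥-term (nonneg ∘ suc) j))

-- Sums Σ_{t<n} h t over an initial segment of ℕ, for arithmetic on indices.

sumRange : ℕ → (ℕ → ℤ∞) → ℤ∞
sumRange zero    h = 0∞
sumRange (suc n) h = h 0 +∞ sumRange n (h ∘ suc)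

sumFin-toℕ : ∀ n (h : ℕ → ℤ∞) → sumFin {n} (h ∘ toℕ) ≡ sumRange n h
sumFin-toℕ zero    h = refl
sumFin-toℕ (suc n) h = cong (h 0 +∞_) (sumFin-toℕ n (h ∘ suc))

sumRange-+ : ∀ p q (h : ℕ → ℤ∞) → sumRange (p + q) h ≡ sumRange p h +∞ sumRange q (λ t → h (p + t))
sumRange-+ zero    q h = ≡-sym (+∞-identityˡ _)
sumRange-+ (suc p) q h = trans (cong (h 0 +∞_) (sumRange-+ p q (h ∘ suc))) (≡-sym (+∞-assoc (h 0) _ _))

sumRange-cong : ∀ n {h h′ : ℕ → ℤ∞} → (∀ t → t < n → h t ≡ h′ t) → sumRange n h ≡ sumRange n h′
sumRange-cong zero    _  = refl
sumRange-cong (suc n) eq = cong₂ _+∞_ (eq 0 (s≤s z≤n)) (sumRange-cong n (λ t t<n → eq (suc t) (s≤s t<n)))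

sumRange-const : ∀ n (z : ℤ) → sumRange n (λ _ → fin z) ≡ fin (+ n ℤ.* z)
sumRange-const zero    z = cong fin (≡-sym (ℤP.*-zeroˡ z))
sumRange-const (suc n) z = trans (cong (fin z +∞_) (sumRange-const n z)) (cong fin (≡-sym (ℤP.suc-* (+ n) z)))

sumRange-nonneg : ∀ n {h : ℕ → ℤ∞} → (∀ t → 0∞ ≤∞ h t) → 0∞ ≤∞ sumRange n h
sumRange-nonneg zero    _      = ≤∞-refl
sumRange-nonneg (suc n) nonneg = +∞-mono-≤∞ (nonneg 0) (sumRange-nonneg n (nonneg ∘ suc))

sumRange-≥-prefix : ∀ p q {h : ℕ → ℤ∞} → (∀ t → 0∞ ≤∞ h (p + t)) → sumRange p h ≤∞ sumRange (p + q) h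
sumRange-≥-prefix p q {h} nonneg = subst₂ _≤∞_ (+∞-identityʳ _) (≡-sym (sumRange-+ p q h))
  (+∞-mono-≤∞ ≤∞-refl (sumRange-nonneg q nonneg))

-- The summand contributed by v to u's utility if u sat in the group labelled k of c,
-- and the resulting utility.  Note utilityOf G c u is, by definition, joinUtility G c u (c u).
joinTerm : (G : Game) → Partition G → (u k v : Fin (n G)) → ℤ∞
joinTerm G c u k v = if not (does (u ≟ v)) ∧ does (k ≟ c v) then w G u v else 0∞

joinUtility : (G : Game) → Partition G → Fin (n G) → Fin (n G) → ℤ∞
joinUtility G c u k = sumFin (joinTerm G c u k)

utility-after-move : ∀ G (c : Partition G) u k → utilityOf G (move G c u k) u ≡ joinUtility G c u k
utility-after-move G c u k = sumFin-cong summand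
  where
  summand : ∀ v → (if not (does (u ≟ v)) ∧ sameGroup (move G c u k) u v then w G u v else 0∞)
                ≡ joinTerm G c u k v
  summand v with u ≟ v
  ... | yes _   = refl
  ... | no  u≢v rewrite dec-true (u ≟ u) refl | dec-false (v ≟ u) (u≢v ∘ ≡-sym) = refl

joinTerm-cases : ∀ G (c : Partition G) u k v (P : ℤ∞ → Set) →
                 P 0∞ → (u ≢ v → c v ≡ k → P (w G u v)) → P (joinTerm G c u k v)
joinTerm-cases G c u k v P p0 pw with u ≟ v
... | yes _ = p0
... | no u≢v with k ≟ c v
...   | yes k≡cv = pw u≢v (≡-sym k≡cv)
...   | no  _    = p0

joinUtility-zero : ∀ G (c : Partition G) u k →
                   (∀ v → u ≢ v → c v ≡ k → w G u v ≡ 0∞) → joinUtility G c u k ≡ 0∞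
joinUtility-zero G c u k zero-weights =
  sumFin-zero (λ v → joinTerm-cases G c u k v (_≡ 0∞) refl (zero-weights v))

joinUtility-empty : ∀ G (c : Partition G) u k → (∀ v → u ≢ v → c v ≢ k) → joinUtility G c u k ≡ 0∞
joinUtility-empty G c u k empty = joinUtility-zero G c u k (λ v u≢v cv≡k → ⊥-elim (empty v u≢v cv≡k))

joinUtility-nonpos : ∀ G (c : Partition G) u k →
                     (∀ v → u ≢ v → c v ≡ k → w G u v ≤∞ 0∞) → joinUtility G c u k ≤∞ 0∞
joinUtility-nonpos G c u k nonpos =
  sumFin-nonpos (λ v → joinTerm-cases G c u k v (_≤∞ 0∞) ≤∞-refl (nonpos v))

joinUtility-enemy : ∀ G (c : Partition G) u k v → u ≢ v → c v ≡ k → w G u v ≡ -∞ →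
                    joinUtility G c u k ≤∞ 0∞
joinUtility-enemy G c u k v u≢v cv≡k enemy = subst (_≤∞ 0∞) (≡-sym (sumFin-−∞ v enemyTerm)) -∞≤
  where
  enemyTerm : joinTerm G c u k v ≡ -∞
  enemyTerm rewrite dec-false (u ≟ v) u≢v | dec-true (k ≟ c v) (≡-sym cv≡k) = enemy

no-gain⇒stable : ∀ G (c : Partition G) → (∀ u → utilityOf G c u ≡ 0∞) →
                 (∀ u k → joinUtility G c u k ≤∞ 0∞) → OneStable G c
no-gain⇒stable G c zero-utility no-gain (u , k , gain) = <∞⇒≱∞ gain
  (subst₂ _≤∞_ (≡-sym (utility-after-move G c u k)) (≡-sym (zero-utility u)) (no-gain u k))

-- The n labels cannot all be used by the n - 1 players other than u: the occupants
-- avoid u, so they fit injectively into Fin (n - 1) (c inverts them).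
labels-not-all-used : ∀ {m} (c : Fin (suc m) → Fin (suc m)) (u : Fin (suc m)) →
                      ¬ (∀ k → ∃[ v ] (v ≢ u × c v ≡ k))
labels-not-all-used {m} c u occupied = ℕP.n≮n m (FP.injective⇒≤ squeezed-injective)
  where
  occupant : Fin (suc m) → Fin (suc m)
  occupant k = proj₁ (occupied k)
  avoids : ∀ k → u ≢ occupant k
  avoids k = proj₁ (proj₂ (occupied k)) ∘ ≡-sym
  labelled : ∀ k → c (occupant k) ≡ k
  labelled k = proj₂ (proj₂ (occupied k))
  squeezed : Fin (suc m) → Fin m
  squeezed k = punchOut (avoids k)
  squeezed-injective : ∀ {i j} → squeezed i ≡ squeezed j → i ≡ j
  squeezed-injective {i} {j} eq = trans (≡-sym (labelled i))
    (trans (cong c (FP.punchOut-injective (avoids i) (avoids j) eq)) (labelled j))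

freeLabel : ∀ {m} (c : Fin m → Fin m) (u : Fin m) → ∃[ k ] (∀ v → u ≢ v → c v ≢ k)
freeLabel {suc m} c u with FP.¬∀⟶∃¬ (suc m) _ occupied? (labels-not-all-used c u)
  where
  occupied? : ∀ k → Dec (∃[ v ] (v ≢ u × c v ≡ k))
  occupied? k = FP.any? (λ v → ¬? (v ≟ u) ×-dec (c v ≟ k))
... | k , unused = k , λ v u≢v cv≡k → unused (v , u≢v ∘ ≡-sym , cv≡k)

-- In a 1-stable partition nobody has negative utility: moving alone would give 0.
stable⇒utility-nonneg : ∀ G (c : Partition G) → OneStable G c → ∀ u → 0∞ ≤∞ utilityOf G c u
stable⇒utility-nonneg G c stable u with ≤∞-or->∞ 0∞ (utilityOf G c u) | freeLabel c u
... | inj₁ nonneg   | _ = nonneg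
... | inj₂ negative | k , free = ⊥-elim (stable (u , k , subst (utilityOf G c u <∞_) alone negative))
  where
  alone : 0∞ ≡ utilityOf G (move G c u k) u
  alone = ≡-sym (trans (utility-after-move G c u k) (joinUtility-empty G c u k free))

zero-stable⇒minimal : ∀ G (P : Partition G) → OneStable G P → globalUtility G P ≡ 0∞ → IsMinOneStable G P
zero-stable⇒minimal G P stable zero-utility = stable , λ Q stableQ →
  subst (_≤∞ globalUtility G Q) (≡-sym zero-utility) (sumFin-nonneg (stable⇒utility-nonneg G Q stableQ))

argmaxFin : ∀ {c} (g : Fin c → ℤ∞) → Fin c → ∃[ a ] (∀ b → g b ≤∞ g a)
argmaxFin {zero}        g ()
argmaxFin {suc zero}    g _ = zero , λ { zero → ≤∞-refl }
argmaxFin {suc (suc c)} g _ with argmaxFin (g ∘ suc) zero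
... | a , max with ≤∞-total (g zero) (g (suc a))
...   | inj₁ le = suc a , λ { zero → le ; (suc b) → max b }
...   | inj₂ ge = zero  , λ { zero → ≤∞-refl ; (suc b) → ≤∞-trans (max b) ge }

-- A functional F on the (inhabited) set of maps Fin k → Fin c, invariant under
-- pointwise equality, attains its maximum; induction on k, choosing the head last.
argmaxMap : ∀ {k c} (F : (Fin k → Fin c) → ℤ∞) → (∀ f g → (∀ i → f i ≡ g i) → F f ≡ F g) →
            (Fin k → Fin c) → ∃[ f ] (∀ g → F g ≤∞ F f)
argmaxMap {zero}  F resp _ = (λ ()) , λ g → ≤∞-reflexive (resp g _ (λ ()))
argmaxMap {suc k} F resp f₀ = best a₀ , maximal
  where
  F-headed : Fin _ → (Fin k → Fin _) → ℤ∞
  F-headed a t = F (a ∷ t)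
  bestTail : ∀ a → ∃[ t ] (∀ t′ → F-headed a t′ ≤∞ F-headed a t)
  bestTail a = argmaxMap (F-headed a) (λ f g eq → resp _ _ λ { zero → refl ; (suc i) → eq i }) (f₀ ∘ suc)
  best : Fin _ → Fin (suc k) → Fin _
  best a = a ∷ proj₁ (bestTail a)
  bestHead : ∃[ a ] (∀ b → F (best b) ≤∞ F (best a))
  bestHead = argmaxFin (F ∘ best) (f₀ zero)
  a₀ : Fin _
  a₀ = proj₁ bestHead
  maximal : ∀ g → F g ≤∞ F (best a₀)
  maximal g = subst (_≤∞ F (best a₀)) (resp (g zero ∷ g ∘ suc) g λ { zero → refl ; (suc i) → refl })
    (≤∞-trans (proj₂ (bestTail (g zero)) (g ∘ suc)) (proj₂ bestHead (g zero)))

-- Colorings are functions, compared pointwise.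
globalUtility-cong : ∀ G (c c′ : Partition G) → (∀ v → c v ≡ c′ v) → globalUtility G c ≡ globalUtility G c′
globalUtility-cong G c c′ eq = sumFin-cong λ u → sumFin-cong λ v →
  cong (λ same → if not (does (u ≟ v)) ∧ same then w G u v else 0∞) (cong₂ (λ x y → does (x ≟ y)) (eq u) (eq v))

maxPartition : ∀ G → ∃[ P ] IsMaxPartition G P
maxPartition G = argmaxMap (globalUtility G) (globalUtility-cong G) (λ v → v)

-- The grand coalition (everyone labelled k₀) is 1-stable with global utility 0 as soon
-- as every player's total weight to the others is 0: leaving means being alone.
grandCoalition-zero-stable : ∀ G (k₀ : Fin (n G)) → (∀ u → utilityOf G (λ _ → k₀) u ≡ 0∞) →
                             OneStable G (λ _ → k₀) × globalUtility G (λ _ → k₀) ≡ 0∞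
grandCoalition-zero-stable G k₀ zero-utility =
  no-gain⇒stable G (λ _ → k₀) zero-utility no-gain , sumFin-zero zero-utility
  where
  no-gain : ∀ u k → joinUtility G (λ _ → k₀) u k ≤∞ 0∞
  no-gain u k = staying-or-leaving (k ≟ k₀)
    where
    staying-or-leaving : Dec (k ≡ k₀) → joinUtility G (λ _ → k₀) u k ≤∞ 0∞
    staying-or-leaving (yes refl) = ≤∞-reflexive (zero-utility u)
    staying-or-leaving (no k≢k₀)  = ≤∞-reflexive (joinUtility-empty G _ u k (λ _ _ k₀≡k → k≢k₀ (≡-sym k₀≡k)))

-- Gather the players in S into the group labelled s ∈ S; everybody else is alone
-- (a player v outside S gets its own label v, which no one else uses).
gather : ∀ {m} → (Fin m → Bool) → Fin m → Fin m → Fin m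
gather S s v = if S v then s else v

if-nonneg : ∀ (b : Bool) {x} → 0∞ ≤∞ x → 0∞ ≤∞ (if b then x else 0∞)
if-nonneg true  nonneg = nonneg
if-nonneg false _      = ≤∞-refl

-- If S has nonnegative internal weights, gathering S gives everyone utility ≥ 0, so
-- the global utility is at least the utility of the gathering point s.
gather-utility-nonneg : ∀ G (S : Fin (n G) → Bool) s → T (S s) →
                        (∀ u v → T (S u) → T (S v) → u ≢ v → 0∞ ≤∞ w G u v) →
                        ∀ u → 0∞ ≤∞ utilityOf G (gather S s) u
gather-utility-nonneg G S s s∈S inner-nonneg u = sumFin-nonneg summand
  where
  summand : ∀ v → 0∞ ≤∞ (if not (does (u ≟ v)) ∧ sameGroup (gather S s) u v then w G u v else 0∞)
  summand v with u ≟ v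
  ... | yes _ = ≤∞-refl
  ... | no u≢v with S u in Su | S v in Sv
  ...   | true  | true  = if-nonneg (does (s ≟ s))
                            (inner-nonneg u v (subst T (≡-sym Su) tt) (subst T (≡-sym Sv) tt) u≢v)
  ...   | false | false rewrite dec-false (u ≟ v) u≢v = ≤∞-refl
  ...   | true  | false with s ≟ v
  ...     | yes refl = ⊥-elim (subst T Sv s∈S)
  ...     | no  _    = ≤∞-refl
  summand v | no u≢v | false | true with u ≟ s
  ...     | yes refl = ⊥-elim (subst T Su s∈S)
  ...     | no  _    = ≤∞-refl

gather-global-≥ : ∀ G (S : Fin (n G) → Bool) s → T (S s) →
                  (∀ u v → T (S u) → T (S v) → u ≢ v → 0∞ ≤∞ w G u v) →
                  utilityOf G (gather S s) s ≤∞ globalUtility G (gather S s)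
gather-global-≥ G S s s∈S inner-nonneg = sumFin-≥-term (gather-utility-nonneg G S s s∈S inner-nonneg) s

separation : (𝒲 : Pred ℤ∞ 0ℓ) (R : ℕ) (G : Game) → WeightsIn 𝒲 G →
             (rich : Partition G) → fin (+ R) ≤∞ globalUtility G rich →
             (poor : Partition G) → OneStable G poor → globalUtility G poor ≡ 0∞ →
             ∃[ G ] (WeightsIn 𝒲 G ×
               (∃[ P⁺ ] (IsMaxPartition G P⁺ × fin (+ R) ≤∞ globalUtility G P⁺)) ×
               (∃[ P⁻ ] (IsMinOneStable G P⁻ × globalUtility G P⁻ ≡ fin (+ 0))))
separation 𝒲 R G weights rich rich-bound poor poor-stable poor-zero with maxPartition G
... | P⁺ , maximum = G , weights , (P⁺ , maximum , ≤∞-trans rich-bound (maximum rich)) ,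
                     (poor , zero-stable⇒minimal G poor poor-stable poor-zero , poor-zero)

-- In the
-- partition {x, ey} {ex, y …} everyone has utility 0 and every move meets an enemy or
-- gains nothing, while gathering x with its followers earns x alone m·b.
module EnemyGadget (m b : ℕ) where

  pattern x   = zero
  pattern ex  = suc zero
  pattern ey  = suc (suc zero)
  pattern y i = suc (suc (suc i))

  data Tie : Set where
    friend enemy neutral : Tie

  value : Tie → ℤ∞
  value friend  = fin (+ b)
  value enemy   = -∞
  value neutral = 0∞

  tie : Fin (3 + m) → Fin (3 + m) → Tie
  tie x      (y _)  = friend
  tie (y _)  x      = friend
  tie x      ex     = enemy
  tie ex     x      = enemy
  tie ey     (y _)  = enemy
  tie (y _)  ey     = enemy
  tie _      _      = neutral

  tie-sym : ∀ u v → tie u v ≡ tie v u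
  tie-sym x     x     = refl
  tie-sym x     ex    = refl
  tie-sym x     ey    = refl
  tie-sym x     (y _) = refl
  tie-sym ex    x     = refl
  tie-sym ex    ex    = refl
  tie-sym ex    ey    = refl
  tie-sym ex    (y _) = refl
  tie-sym ey    x     = refl
  tie-sym ey    ex    = refl
  tie-sym ey    ey    = refl
  tie-sym ey    (y _) = refl
  tie-sym (y _) x     = refl
  tie-sym (y _) ex    = refl
  tie-sym (y _) ey    = refl
  tie-sym (y _) (y _) = refl

  game : Game
  game = record { n = 3 + m ; w = λ u v → value (tie u v) ; sym = λ u v → cong value (tie-sym u v) }

  weights : (𝒲 : Pred ℤ∞ 0ℓ) → 𝒲 -∞ → 𝒲 (fin (+ 0)) → 𝒲 (fin (+ b)) → WeightsIn 𝒲 game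
  weights 𝒲 w∞ w0 wb u v _ = value∈𝒲 (tie u v)
    where
    value∈𝒲 : ∀ t → 𝒲 (value t)
    value∈𝒲 friend  = wb
    value∈𝒲 enemy   = w∞
    value∈𝒲 neutral = w0

  poor : Partition game
  poor x     = zero
  poor ex    = suc zero
  poor ey    = zero
  poor (y _) = suc zero

  poor-utility : ∀ u → utilityOf game poor u ≡ 0∞
  poor-utility x     = joinUtility-zero game poor x zero
    λ { x _ _ → refl ; ex _ () ; ey _ _ → refl ; (y _) _ () }
  poor-utility ex    = joinUtility-zero game poor ex (suc zero)
    λ { x _ () ; ex _ _ → refl ; ey _ () ; (y _) _ _ → refl }
  poor-utility ey    = joinUtility-zero game poor ey zero
    λ { x _ _ → refl ; ex _ () ; ey _ _ → refl ; (y _) _ () }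
  poor-utility (y j) = joinUtility-zero game poor (y j) (suc zero)
    λ { x _ () ; ex _ _ → refl ; ey _ () ; (y _) _ _ → refl }

  -- x may only gain with its followers, who sit with its enemy ex; a follower may
  -- only gain with x, who sits with its enemy ey; ex and ey like nobody.
  poor-no-gain : ∀ u k → joinUtility game poor u k ≤∞ 0∞
  poor-no-gain u     (suc (suc k)) = ≤∞-reflexive (joinUtility-empty game poor u (suc (suc k)) (λ v _ → unused v))
    where
    unused : ∀ v → poor v ≢ suc (suc k)
    unused x     ()
    unused ex    ()
    unused ey    ()
    unused (y _) ()
  poor-no-gain x     (suc zero) = joinUtility-enemy game poor x (suc zero) ex (λ ()) refl refl
  poor-no-gain x     zero       = joinUtility-nonpos game poor x zero
    λ { x _ _ → ≤∞-refl ; ex _ _ → -∞≤ ; ey _ _ → ≤∞-refl ; (y _) _ () }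
  poor-no-gain ex    k          = joinUtility-nonpos game poor ex k
    λ { x _ _ → -∞≤ ; ex _ _ → ≤∞-refl ; ey _ _ → ≤∞-refl ; (y _) _ _ → ≤∞-refl }
  poor-no-gain ey    k          = joinUtility-nonpos game poor ey k
    λ { x _ _ → ≤∞-refl ; ex _ _ → ≤∞-refl ; ey _ _ → ≤∞-refl ; (y _) _ _ → -∞≤ }
  poor-no-gain (y j) zero       = joinUtility-enemy game poor (y j) zero ey (λ ()) refl refl
  poor-no-gain (y j) (suc zero) = joinUtility-nonpos game poor (y j) (suc zero)
    λ { x _ () ; ex _ _ → ≤∞-refl ; ey _ _ → -∞≤ ; (y _) _ _ → ≤∞-refl }

  poor-stable : OneStable game poor
  poor-stable = no-gain⇒stable game poor poor-utility poor-no-gain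

  poor-zero : globalUtility game poor ≡ 0∞
  poor-zero = sumFin-zero poor-utility

  friendly : Fin (3 + m) → Bool
  friendly x     = true
  friendly ex    = false
  friendly ey    = false
  friendly (y _) = true

  rich : Partition game
  rich = gather friendly x

  friendly-nonneg : ∀ u v → T (friendly u) → T (friendly v) → u ≢ v → 0∞ ≤∞ w game u v
  friendly-nonneg x     x     _ _ _ = ≤∞-refl
  friendly-nonneg x     (y _) _ _ _ = fin≤ (ℤ.+≤+ z≤n)
  friendly-nonneg (y _) x     _ _ _ = fin≤ (ℤ.+≤+ z≤n)
  friendly-nonneg (y _) (y _) _ _ _ = ≤∞-refl

  hub-utility : utilityOf game rich x ≡ fin (+ m ℤ.* + b)
  hub-utility = begin
      0∞ +∞ (0∞ +∞ (0∞ +∞ sumFin {m} (λ _ → fin (+ b))))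
    ≡⟨ trans (+∞-identityˡ _) (trans (+∞-identityˡ _) (+∞-identityˡ _)) ⟩
      sumFin {m} (λ _ → fin (+ b))
    ≡⟨ sumFin-toℕ m (λ _ → fin (+ b)) ⟩
      sumRange m (λ _ → fin (+ b))
    ≡⟨ sumRange-const m (+ b) ⟩
      fin (+ m ℤ.* + b) ∎
    where open ≡-Reasoning

  rich-bound : 1 ≤ b → fin (+ m) ≤∞ globalUtility game rich
  rich-bound 1≤b = ≤∞-trans (≤∞-product m b (≤-scale m 1≤b))
    (subst (_≤∞ globalUtility game rich) hub-utility (gather-global-≥ game friendly x tt friendly-nonneg))

-- F is palindromic on [0, N] when F d = F e whenever d + e = N with d, e > 0;
-- then F |u - v| depends only on u - v modulo N.
Palindromic : ℕ → (ℕ → ℤ∞) → Set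
Palindromic N F = ∀ d e → d + e ≡ N → 0 < d → 0 < e → F d ≡ F e

-- For palindromic F every row of the distance matrix has the same sum: the terms
-- F (i - j), j < i, are the terms F (r + j) of the wrapped-around row.
row-sum : ∀ {N F} → Palindromic N F → ∀ i r → i + r ≡ N → 0 < r →
          sumRange N (λ j → F ∣ i - j ∣) ≡ sumRange N F
row-sum {N} {F} palindromic i r i+r≡N 0<r = begin
    sumRange N (λ j → F ∣ i - j ∣)
  ≡⟨ cong (λ N′ → sumRange N′ (λ j → F ∣ i - j ∣)) (≡-sym i+r≡N) ⟩
    sumRange (i + r) (λ j → F ∣ i - j ∣)
  ≡⟨ sumRange-+ i r _ ⟩
    sumRange i (λ j → F ∣ i - j ∣) +∞ sumRange r (λ t → F ∣ i - i + t ∣)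
  ≡⟨ cong₂ _+∞_ (sumRange-cong i before) (sumRange-cong r (λ t _ → cong F (ℕP.∣m-m+n∣≡n i t))) ⟩
    sumRange i (λ j → F (r + j)) +∞ sumRange r F
  ≡⟨ +∞-comm _ _ ⟩
    sumRange r F +∞ sumRange i (λ j → F (r + j))
  ≡⟨ ≡-sym (sumRange-+ r i F) ⟩
    sumRange (r + i) F
  ≡⟨ cong (λ N′ → sumRange N′ F) (trans (ℕP.+-comm r i) i+r≡N) ⟩
    sumRange N F ∎
  where
  open ≡-Reasoning
  before : ∀ j → j < i → F ∣ i - j ∣ ≡ F (r + j)
  before j j<i = trans (cong F (ℕP.m≤n⇒∣n-m∣≡n∸m (ℕP.<⇒≤ j<i)))
    (palindromic (i ∸ j) (r + j) complementary (ℕP.m<n⇒0<n∸m j<i) (ℕP.<-≤-trans 0<r (ℕP.m≤m+n r j)))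
    where
    complementary : i ∸ j + (r + j) ≡ N
    complementary = begin
      i ∸ j + (r + j) ≡⟨ cong (λ z → i ∸ j + z) (ℕP.+-comm r j) ⟩
      i ∸ j + (j + r) ≡⟨ ≡-sym (ℕP.+-assoc (i ∸ j) j r) ⟩
      i ∸ j + j + r   ≡⟨ cong (_+ r) (ℕP.m∸n+n≡m (ℕP.<⇒≤ j<i)) ⟩
      i + r           ≡⟨ i+r≡N ⟩
      N               ∎

circulant : ℕ → (ℕ → ℤ∞) → Game
circulant N F = record
  { n = N ; w = λ u v → F ∣ toℕ u - toℕ v ∣ ; sym = λ u v → cong F (ℕP.∣-∣-comm (toℕ u) (toℕ v)) }

circulant-grand-utility : ∀ {N F} → F 0 ≡ 0∞ → Palindromic N F → ∀ (k₀ u : Fin N) →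
                          utilityOf (circulant N F) (λ _ → k₀) u ≡ sumRange N F
circulant-grand-utility {N} {F} F0≡0 palindromic k₀ u = begin
    utilityOf (circulant N F) (λ _ → k₀) u
  ≡⟨ sumFin-cong summand ⟩
    sumFin {N} (λ v → F ∣ toℕ u - toℕ v ∣)
  ≡⟨ sumFin-toℕ N (λ j → F ∣ toℕ u - j ∣) ⟩
    sumRange N (λ j → F ∣ toℕ u - j ∣)
  ≡⟨ row-sum palindromic (toℕ u) (N ∸ toℕ u) (ℕP.m+[n∸m]≡n (ℕP.<⇒≤ (FP.toℕ<n u))) (ℕP.m<n⇒0<n∸m (FP.toℕ<n u)) ⟩
    sumRange N F ∎
  where
  open ≡-Reasoning
  summand : ∀ v → (if not (does (u ≟ v)) ∧ does (k₀ ≟ k₀) then F ∣ toℕ u - toℕ v ∣ else 0∞)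
                ≡ F ∣ toℕ u - toℕ v ∣
  summand v with u ≟ v
  ... | yes refl = trans (≡-sym F0≡0) (cong F (≡-sym (ℕP.∣n-n∣≡0 (toℕ u))))
  ... | no  _    rewrite dec-true (k₀ ≟ k₀) refl = refl

-- 2·(ka)·b = (2kb)·a: the positive and negative stretches of a band row cancel.
band-balance : ∀ k a b →
  + (k * a) ℤ.* + b ℤ.+ + (k * b + k * b) ℤ.* - (+ a) ℤ.+ + (k * a) ℤ.* + b ≡ + 0
band-balance k a b = subst₂ (λ K L → K ℤ.* + b ℤ.+ L ℤ.* - (+ a) ℤ.+ K ℤ.* + b ≡ + 0)
  (≡-sym (ℤP.pos-* k a))
  (≡-sym (trans (ℤP.pos-+ (k * b) (k * b)) (cong₂ ℤ._+_ (ℤP.pos-* k b) (ℤP.pos-* k b))))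
  (identity (+ k) (+ a) (+ b))
  where
  identity : ∀ κ α β → κ ℤ.* α ℤ.* β ℤ.+ (κ ℤ.* β ℤ.+ κ ℤ.* β) ℤ.* - α ℤ.+ κ ℤ.* α ℤ.* β ≡ + 0
  identity = solve-∀

-- Each row has 2K entries b and L entries
-- -a, so the grand coalition is 1-stable with utility 0, while gathering the K + 1
-- players 0 … K earns player 0 alone K·b.
module BandGame (a b k : ℕ) where

  K L M : ℕ
  K = k * a
  L = k * b + k * b
  M = K + L + K

  InMiddle : ℕ → Set
  InMiddle t = K ≤ t × t < K + L

  inMiddle? : ∀ t → Dec (InMiddle t)
  inMiddle? t = K ℕ.≤? t ×-dec t ℕ.<? K + L

  -- The weight at distance 1 + t: -a on the middle stretch K ≤ t < K + L, b elsewhere.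
  band : ℕ → ℤ∞
  band zero    = 0∞
  band (suc t) = if does (inMiddle? t) then fin (- (+ a)) else fin (+ b)

  band-middle : ∀ {t} → InMiddle t → band (suc t) ≡ fin (- (+ a))
  band-middle {t} middle rewrite dec-true (inMiddle? t) middle = refl

  band-outer : ∀ {t} → ¬ InMiddle t → band (suc t) ≡ fin (+ b)
  band-outer {t} outer rewrite dec-false (inMiddle? t) outer = refl

  middle-mirror : ∀ {t s} → suc (t + s) ≡ M → InMiddle t → InMiddle s
  middle-mirror {t} {s} t+s+1≡M (K≤t , t<K+L) = K≤s , s<K+L
    where
    K≤s : K ≤ s
    K≤s = ℕP.≮⇒≥ λ s<K → ℕP.n≮n M
      (subst (_≤ M) (trans (cong suc (ℕP.+-suc t s)) (cong suc t+s+1≡M)) (ℕP.+-mono-≤ t<K+L s<K))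
    s<K+L : s < K + L
    s<K+L = ℕP.≰⇒> λ K+L≤s → ℕP.n≮n M
      (subst (suc M ≤_) t+s+1≡M (s≤s (subst (_≤ t + s) (ℕP.+-comm K (K + L)) (ℕP.+-mono-≤ K≤t K+L≤s))))

  band-palindromic : Palindromic (suc M) band
  band-palindromic (suc t) (suc s) 1+t+1+s≡N _ _ =
    cong (λ middle → if middle then fin (- (+ a)) else fin (+ b)) mirrored
    where
    t+s+1≡M : suc (t + s) ≡ M
    t+s+1≡M = trans (≡-sym (ℕP.+-suc t s)) (ℕP.suc-injective 1+t+1+s≡N)
    mirrored : does (inMiddle? t) ≡ does (inMiddle? s)
    mirrored = agree (inMiddle? t) (inMiddle? s)
      where
      agree : (t? : Dec (InMiddle t)) (s? : Dec (InMiddle s)) → does t? ≡ does s?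
      agree (yes _)       (yes _)       = refl
      agree (no  _)       (no  _)       = refl
      agree (yes middle)  (no  ¬middle) = ⊥-elim (¬middle (middle-mirror t+s+1≡M middle))
      agree (no  ¬middle) (yes middle)  =
        ⊥-elim (¬middle (middle-mirror (trans (cong suc (ℕP.+-comm s t)) t+s+1≡M) middle))

  band-sum : sumRange (suc M) band ≡ 0∞
  band-sum = begin
      0∞ +∞ sumRange (K + L + K) (band ∘ suc)
    ≡⟨ +∞-identityˡ _ ⟩
      sumRange (K + L + K) (band ∘ suc)
    ≡⟨ sumRange-+ (K + L) K _ ⟩
      sumRange (K + L) (band ∘ suc) +∞ sumRange K (λ t → band (suc (K + L + t)))
    ≡⟨ cong (_+∞ sumRange K (λ t → band (suc (K + L + t)))) (sumRange-+ K L _) ⟩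
      sumRange K (band ∘ suc) +∞ sumRange L (λ t → band (suc (K + t))) +∞ sumRange K (λ t → band (suc (K + L + t)))
    ≡⟨ cong₂ _+∞_ (cong₂ _+∞_ (sumRange-cong K first) (sumRange-cong L middle)) (sumRange-cong K last) ⟩
      sumRange K (λ _ → fin (+ b)) +∞ sumRange L (λ _ → fin (- (+ a))) +∞ sumRange K (λ _ → fin (+ b))
    ≡⟨ cong₂ _+∞_ (cong₂ _+∞_ (sumRange-const K (+ b)) (sumRange-const L (- (+ a)))) (sumRange-const K (+ b)) ⟩
      fin (+ K ℤ.* + b ℤ.+ + L ℤ.* - (+ a) ℤ.+ + K ℤ.* + b)
    ≡⟨ cong fin (band-balance k a b) ⟩
      0∞ ∎
    where
    open ≡-Reasoning
    first : ∀ t → t < K → band (suc t) ≡ fin (+ b)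
    first t t<K = band-outer (λ middle → ℕP.<⇒≱ t<K (proj₁ middle))
    middle : ∀ t → t < L → band (suc (K + t)) ≡ fin (- (+ a))
    middle t t<L = band-middle (ℕP.m≤m+n K t , ℕP.+-monoʳ-< K t<L)
    last : ∀ t → t < K → band (suc (K + L + t)) ≡ fin (+ b)
    last t _ = band-outer (λ middle → ℕP.m+n≮m (K + L) t (proj₂ middle))

  game : Game
  game = circulant (suc M) band

  weights : (𝒲 : Pred ℤ∞ 0ℓ) → 𝒲 (fin (- (+ a))) → 𝒲 (fin (+ b)) → WeightsIn 𝒲 game
  weights 𝒲 wa wb u v u≢v = band∈𝒲 ∣ toℕ u - toℕ v ∣ distinct
    where
    distinct : ∣ toℕ u - toℕ v ∣ ≢ 0
    distinct d≡0 = u≢v (FP.toℕ-injective (ℕP.∣m-n∣≡0⇒m≡n d≡0))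
    band∈𝒲 : ∀ d → d ≢ 0 → 𝒲 (band d)
    band∈𝒲 zero    d≢0 = ⊥-elim (d≢0 refl)
    band∈𝒲 (suc t) _   = by-stretch (inMiddle? t)
      where
      by-stretch : (t? : Dec (InMiddle t)) → 𝒲 (if does t? then fin (- (+ a)) else fin (+ b))
      by-stretch (yes _) = wa
      by-stretch (no  _) = wb

  poor : Partition game
  poor _ = zero

  poor-stable-zero : OneStable game poor × globalUtility game poor ≡ 0∞
  poor-stable-zero = grandCoalition-zero-stable game zero
    (λ u → trans (circulant-grand-utility refl band-palindromic zero u) band-sum)

  near : Fin (suc M) → Bool
  near v = toℕ v ≤ᵇ K

  rich : Partition game
  rich = gather near zero

  band-near-nonneg : ∀ {d} → d ≤ K → 0∞ ≤∞ band d
  band-near-nonneg {zero}  _   = ≤∞-refl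
  band-near-nonneg {suc t} t<K =
    subst (0∞ ≤∞_) (≡-sym (band-outer (λ middle → ℕP.<⇒≱ t<K (proj₁ middle)))) (fin≤ (ℤ.+≤+ z≤n))

  near-nonneg : ∀ u v → T (near u) → T (near v) → u ≢ v → 0∞ ≤∞ w game u v
  near-nonneg u v u-near v-near _ = band-near-nonneg
    (ℕP.≤-trans (ℕP.∣m-n∣≤m⊔n (toℕ u) (toℕ v)) (ℕP.⊔-lub (ℕP.≤ᵇ⇒≤ (toℕ u) K u-near) (ℕP.≤ᵇ⇒≤ (toℕ v) K v-near)))

  hubTerm : ℕ → ℤ∞
  hubTerm t = if t <ᵇ K then fin (+ b) else 0∞

  hubTerm-inner : ∀ t → t < K → hubTerm t ≡ fin (+ b)
  hubTerm-inner t t<K with t <ᵇ K | ℕP.<⇒<ᵇ t<K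
  ... | true | _ = refl

  hub-utility : utilityOf game rich zero ≡ sumRange M hubTerm
  hub-utility = trans (+∞-identityˡ _) (trans (sumFin-cong summand) (sumFin-toℕ M hubTerm))
    where
    summand : ∀ j → (if does (zero ≟ gather near zero (suc j)) then band (suc (toℕ j)) else 0∞) ≡ hubTerm (toℕ j)
    summand j with toℕ j <ᵇ K in inner
    ... | true  = band-outer (λ middle → ℕP.<⇒≱ (ℕP.<ᵇ⇒< _ _ (subst T (≡-sym inner) tt)) (proj₁ middle))
    ... | false = refl

  hub-bound : fin (+ K ℤ.* + b) ≤∞ utilityOf game rich zero
  hub-bound = subst₂ _≤∞_
    (trans (sumRange-cong K hubTerm-inner) (sumRange-const K (+ b)))
    (≡-sym (trans hub-utility (cong (λ N → sumRange N hubTerm) (ℕP.+-assoc K L K))))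
    (sumRange-≥-prefix K (L + K) (λ t → if-nonneg (K + t <ᵇ K) (fin≤ (ℤ.+≤+ z≤n))))

  rich-bound : 1 ≤ a → 1 ≤ b → fin (+ k) ≤∞ globalUtility game rich
  rich-bound 1≤a 1≤b = ≤∞-trans (≤∞-product K b (ℕP.≤-trans (≤-scale k 1≤a) (≤-scale K 1≤b)))
    (≤∞-trans hub-bound (gather-global-≥ game near zero tt near-nonneg))

-- Each weight hypothesis is served by its gadget with R followers (resp. k = R).
lemma6 : (a b : ℕ) → 1 ≤ a → 1 ≤ b → (𝒲 : Pred ℤ∞ 0ℓ) →
         ((𝒲 -∞ × 𝒲 (fin (+ 0)) × 𝒲 (fin (+ b))) ⊎ (𝒲 (fin (- (+ a))) × 𝒲 (fin (+ b)))) →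
         (R : ℕ) → 1 ≤ R →
         ∃[ G ] (WeightsIn 𝒲 G ×
           (∃[ P⁺ ] (IsMaxPartition G P⁺ × fin (+ R) ≤∞ globalUtility G P⁺)) ×
           (∃[ P⁻ ] (IsMinOneStable G P⁻ × globalUtility G P⁻ ≡ fin (+ 0))))
lemma6 a b _ 1≤b 𝒲 (inj₁ (w∞ , w0 , wb)) R _ =
  separation 𝒲 R game (weights 𝒲 w∞ w0 wb) rich (rich-bound 1≤b) poor poor-stable poor-zero
  where open EnemyGadget R b
lemma6 a b 1≤a 1≤b 𝒲 (inj₂ (wa , wb)) R _ =
  separation 𝒲 R game (weights 𝒲 wa wb) rich (rich-bound 1≤a 1≤b)
    poor (proj₁ poor-stable-zero) (proj₂ poor-stable-zero)
  where open BandGame a b R
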